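{- For all integers $m\geq0$ and $n\geq0$, \[B^{\pm}(24\cdot2^m n+x_m)\equiv B^{\pm}(x_m)+2^{m+5}n\pmod{2^{m+6}}.\]
   Context: $B^{\pm}(n)=\sum_{k=0}^n(-1)^kS(n,k)$ with $S(n,k)$ the Stirling numbers of the second kind; $\nu_2$ is the $2$-adic valuation with $\nu_2(0)=\infty$. Define $y_0=1$ and, for $m\ge0$, $y_{m+1}=y_m$ if $\nu_2(B^{\pm}(24y_m+14))>m+5$, and $y_{m+1}=2^m+y_m$ if $\nu_2(B^{\pm}(24y_m+14))\leq m+5$. Set $x_m=24y_m+14$. -}

module Defs where

open import Data.Nat as ℕ using (ℕ; zero; suc; _^_)
open import Data.Nat.Divisibility as ℕD using (_∣?_)
open import Data.Integer as ℤ using (ℤ; +_; ∣_∣)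
open import Relation.Nullary using (yes; no)

S : ℕ → ℕ → ℕ
S zero    zero    = 1
S zero    (suc k) = 0
S (suc n) zero    = 0
S (suc n) (suc k) = suc k ℕ.* S n (suc k) ℕ.+ S n k

sgn : ℕ → ℤ
sgn zero    = ℤ.+ 1
sgn (suc k) = ℤ.- sgn k

partial : ℕ → ℕ → ℤ
partial n zero    = sgn 0 ℤ.* (+ S n 0)
partial n (suc j) = partial n j ℤ.+ sgn (suc j) ℤ.* (+ S n (suc j))

Bpm : ℕ → ℤ
Bpm n = partial n n

-- y_{m+1} from y_m : the test ν₂(b) > m+5 is exactly 2^(m+6) ∣ b
-- (with ν₂(0)=∞ this holds for b = 0 as well)
step : ℕ → ℕ → ℕ
step m y with (2 ^ (m ℕ.+ 6)) ∣? ∣ Bpm (24 ℕ.* y ℕ.+ 14) ∣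
... | yes _ = y
... | no  _ = 2 ^ m ℕ.+ y

y : ℕ → ℕ
y zero    = 1
y (suc m) = step m (y m)

x : ℕ → ℕ
x m = 24 ℕ.* y m ℕ.+ 14

-- Replace S by the shifted Stirling numbers S⁺(s,b,k) of (t+s)^b = Σₖ S⁺(s,b,k)·t(t-1)⋯(t-k+1): the resulting
-- grid Bₛ(b) has B₀ = B^± and Bₛ(b+1) = s·Bₛ(b) − B_{s+1}(b). Say a function of s has weight n when its k-th
-- step-2 difference is divisible by 2^⌈(n+k)/2⌉; since Δ₂(s·f) = s·Δ₂f + 2·f(s+2), every column b ↦ Bₛ(b) has
-- weight 0. Through the recurrence, u ↦ u(b+2) − u(b+1) − u(b) raises the weight of a grid row by one, hence so
-- does Δ₃, and Δ_{2N} = Δ_N² + 2Δ_N makes Δ_{6·2^K} raise it by 2K+2. Thus Δ₂₄B^± is 24-periodic modulo 2⁶ and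
-- Δ₂₄²B^± modulo 2⁷, and their values at 14 are 32 mod 64 and 0 mod 128. Doubling, Δ_{24·2^m}B^±(x) ≡ 2^{m+5}
-- modulo 2^{m+6} for all x ≡ 14 (mod 24), and summing these differences gives the theorem: only x_m ≡ 14 (mod 24)
-- matters.

module Submission where

open import Defs
open import Data.Nat as ℕ using (ℕ; zero; suc; _≤_; _<_; s≤s; _^_; ⌈_/2⌉)
import Data.Nat.Properties as ℕP
open import Data.Integer as ℤ using (ℤ; +_; _+_; _*_; -_; _-_)
import Data.Integer.Properties as ℤP
import Data.Integer.Divisibility as Unsigned
open import Data.Integer.Divisibility.Signed
  using (_∣_; _∣?_; divides; ∣⇒∣ᵤ; ∣ᵤ⇒∣; ∣-trans; ∣m∣n⇒∣m+n; ∣n⇒∣m*n;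
         *-monoʳ-∣; *-monoˡ-∣)
import Data.Nat.Divisibility as ℕD
open import Data.List using (List; []; _∷_)
open import Relation.Nullary.Decidable using (toWitness)
open import Relation.Binary.PropositionalEquality
import Data.Integer.Tactic.RingSolver as ℤSolver
import Data.Nat.Tactic.RingSolver as ℕSolver

-- Shifted Stirling numbers and the shifted B^±

-- (t + s)^b = Σₖ shiftedS s b k · t(t-1)⋯(t-k+1), so that shiftedS 0 = S.
shiftedS : ℕ → ℕ → ℕ → ℕ
shiftedS s zero    zero    = 1
shiftedS s zero    (suc k) = 0
shiftedS s (suc b) zero    = s ℕ.* shiftedS s b zero
shiftedS s (suc b) (suc k) = shiftedS s b k ℕ.+ (suc k ℕ.+ s) ℕ.* shiftedS s b (suc k)

shiftedS-zero : ∀ b k → shiftedS 0 b k ≡ S b k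
shiftedS-zero zero    zero    = refl
shiftedS-zero zero    (suc k) = refl
shiftedS-zero (suc b) zero    = refl
shiftedS-zero (suc b) (suc k)
  rewrite shiftedS-zero b k | shiftedS-zero b (suc k) | ℕP.+-identityʳ k =
  ℕP.+-comm (S b k) (suc k ℕ.* S b (suc k))

shiftedS-vanish : ∀ s b k → b < k → shiftedS s b k ≡ 0
shiftedS-vanish s zero    (suc k) _ = refl
shiftedS-vanish s (suc b) (suc k) (s≤s b<k)
  rewrite shiftedS-vanish s b k b<k | shiftedS-vanish s b (suc k) (ℕP.m<n⇒m<1+n b<k) =
  ℕP.*-zeroʳ (suc k ℕ.+ s)

shiftedS-suc : ∀ s b k → shiftedS (suc s) b k ≡ shiftedS s b k ℕ.+ suc k ℕ.* shiftedS s b (suc k)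
shiftedS-suc s zero    zero    = refl
shiftedS-suc s zero    (suc k) = sym (ℕP.*-zeroʳ (suc (suc k)))
shiftedS-suc s (suc b) zero    rewrite shiftedS-suc s b 0 = identity (shiftedS s b 0) (shiftedS s b 1) s
  where
  identity : ∀ a c s → suc s ℕ.* (a ℕ.+ 1 ℕ.* c) ≡ s ℕ.* a ℕ.+ 1 ℕ.* (a ℕ.+ (1 ℕ.+ s) ℕ.* c)
  identity = ℕSolver.solve-∀
shiftedS-suc s (suc b) (suc k) rewrite shiftedS-suc s b k | shiftedS-suc s b (suc k) =
  identity (shiftedS s b k) (shiftedS s b (suc k)) (shiftedS s b (suc (suc k))) k s
  where
  identity : ∀ a c d k s →
    (a ℕ.+ suc k ℕ.* c) ℕ.+ (suc k ℕ.+ suc s) ℕ.* (c ℕ.+ suc (suc k) ℕ.* d)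
    ≡ (a ℕ.+ (suc k ℕ.+ s) ℕ.* c) ℕ.+ suc (suc k) ℕ.* (c ℕ.+ (suc (suc k) ℕ.+ s) ℕ.* d)
  identity = ℕSolver.solve-∀

alt : (ℕ → ℤ) → ℕ → ℤ
alt c zero    = sgn 0 * c 0
alt c (suc M) = alt c M + sgn (suc M) * c (suc M)

alt-cong : ∀ {c d} → (∀ k → c k ≡ d k) → ∀ M → alt c M ≡ alt d M
alt-cong c≡d zero    = cong (sgn 0 *_) (c≡d 0)
alt-cong c≡d (suc M) = cong₂ (λ u v → u + sgn (suc M) * v) (alt-cong c≡d M) (c≡d (suc M))

alt-+ : ∀ c d M → alt (λ k → c k + d k) M ≡ alt c M + alt d M
alt-+ c d zero    = ℤP.*-distribˡ-+ (sgn 0) (c 0) (d 0)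
alt-+ c d (suc M) rewrite alt-+ c d M =
  identity (alt c M) (alt d M) (sgn (suc M)) (c (suc M)) (d (suc M))
  where
  identity : ∀ A D σ x y → A + D + σ * (x + y) ≡ A + σ * x + (D + σ * y)
  identity = ℤSolver.solve-∀

alt-* : ∀ a c M → alt (λ k → a * c k) M ≡ a * alt c M
alt-* a c zero    = identity a (c 0)
  where
  identity : ∀ a x → + 1 * (a * x) ≡ a * (+ 1 * x)
  identity = ℤSolver.solve-∀
alt-* a c (suc M) rewrite alt-* a c M = identity a (alt c M) (sgn (suc M)) (c (suc M))
  where
  identity : ∀ a A σ x → a * A + σ * (a * x) ≡ a * (A + σ * x)
  identity = ℤSolver.solve-∀

shiftʳ : (ℕ → ℤ) → ℕ → ℤ
shiftʳ c zero    = + 0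
shiftʳ c (suc k) = c k

alt-shiftʳ : ∀ c M → alt (shiftʳ c) (suc M) ≡ - alt c M
alt-shiftʳ c zero    = identity (c 0)
  where
  identity : ∀ x → + 1 * + 0 + - (+ 1) * x ≡ - (+ 1 * x)
  identity = ℤSolver.solve-∀
alt-shiftʳ c (suc M) rewrite alt-shiftʳ c M = identity (alt c M) (sgn (suc M)) (c (suc M))
  where
  identity : ∀ A σ x → - A + - σ * x ≡ - (A + σ * x)
  identity = ℤSolver.solve-∀

alt-shiftˡ : ∀ c M → alt (λ k → c (suc k)) M ≡ c 0 - alt c (suc M)
alt-shiftˡ c zero    = identity (c 0) (c 1)
  where
  identity : ∀ x y → + 1 * y ≡ x - (+ 1 * x + - (+ 1) * y)
  identity = ℤSolver.solve-∀
alt-shiftˡ c (suc M) rewrite alt-shiftˡ c M = identity (c 0) (alt c (suc M)) (sgn (suc M)) (c (suc (suc M)))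
  where
  identity : ∀ x A σ y → x - A + σ * y ≡ x - (A + - σ * y)
  identity = ℤSolver.solve-∀

Bpmₛ : ℕ → ℕ → ℤ
Bpmₛ s b = alt (λ k → + shiftedS s b k) b

partial≡alt : ∀ n j → partial n j ≡ alt (λ k → + S n k) j
partial≡alt n zero    = refl
partial≡alt n (suc j) = cong (_+ sgn (suc j) * + S n (suc j)) (partial≡alt n j)

Bpmₛ-zero : ∀ b → Bpmₛ 0 b ≡ Bpm b
Bpmₛ-zero b = trans (alt-cong (λ k → cong +_ (shiftedS-zero b k)) b) (sym (partial≡alt b b))

shiftedS-suc-coefficients : ∀ s b k → let c = λ k → + shiftedS s b k in
  + shiftedS s (suc b) k ≡ shiftʳ c k + (+ s * c k + + k * c k)
shiftedS-suc-coefficients s b zero = trans (ℤP.pos-* s _) (identity (+ s) (+ shiftedS s b 0))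
  where
  identity : ∀ s x → s * x ≡ + 0 + (s * x + + 0 * x)
  identity = ℤSolver.solve-∀
shiftedS-suc-coefficients s b (suc k) = begin
  + (shiftedS s b k ℕ.+ (suc k ℕ.+ s) ℕ.* shiftedS s b (suc k))
    ≡⟨ ℤP.pos-+ (shiftedS s b k) _ ⟩
  + shiftedS s b k + + ((suc k ℕ.+ s) ℕ.* shiftedS s b (suc k))
    ≡⟨ cong (_+_ (+ shiftedS s b k))
            (trans (ℤP.pos-* (suc k ℕ.+ s) _) (cong (_* + shiftedS s b (suc k)) (ℤP.pos-+ (suc k) s))) ⟩
  + shiftedS s b k + (+ suc k + + s) * + shiftedS s b (suc k)
    ≡⟨ identity (+ shiftedS s b k) (+ shiftedS s b (suc k)) (+ s) (+ suc k) ⟩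
  + shiftedS s b k + (+ s * + shiftedS s b (suc k) + + suc k * + shiftedS s b (suc k)) ∎
  where
  open ≡-Reasoning
  identity : ∀ a c s k → a + (k + s) * c ≡ a + (s * c + k * c)
  identity = ℤSolver.solve-∀

alt-suc-vanish : ∀ c M → c (suc M) ≡ + 0 → alt c (suc M) ≡ alt c M
alt-suc-vanish c M c[1+M]≡0 =
  trans (cong (λ x → alt c M + sgn (suc M) * x) c[1+M]≡0)
        (trans (cong (_+_ (alt c M)) (ℤP.*-zeroʳ (sgn (suc M)))) (ℤP.+-identityʳ (alt c M)))

signedMoment : ℕ → ℕ → ℤ
signedMoment s b = alt (λ k → + k * + shiftedS s b k) (suc b)

Bpmₛ-suc-expansion : ∀ s b → Bpmₛ s (suc b) ≡ - Bpmₛ s b + (+ s * Bpmₛ s b + signedMoment s b)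
Bpmₛ-suc-expansion s b = begin
  Bpmₛ s (suc b)
    ≡⟨ alt-cong (shiftedS-suc-coefficients s b) (suc b) ⟩
  alt (λ k → shiftʳ c k + (+ s * c k + d k)) (suc b)
    ≡⟨ alt-+ (shiftʳ c) _ (suc b) ⟩
  alt (shiftʳ c) (suc b) + alt (λ k → + s * c k + d k) (suc b)
    ≡⟨ cong₂ _+_ (alt-shiftʳ c b) (trans (alt-+ _ d (suc b)) (cong (_+ alt d (suc b)) (alt-* (+ s) c (suc b)))) ⟩
  - alt c b + (+ s * alt c (suc b) + alt d (suc b))
    ≡⟨ cong (λ x → - alt c b + (+ s * x + alt d (suc b)))
            (alt-suc-vanish c b (cong +_ (shiftedS-vanish s b (suc b) ℕP.≤-refl))) ⟩
  - Bpmₛ s b + (+ s * Bpmₛ s b + signedMoment s b) ∎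
  where
  open ≡-Reasoning
  c d : ℕ → ℤ
  c k = + shiftedS s b k
  d k = + k * c k

Bpmₛ-shift-expansion : ∀ s b → Bpmₛ (suc s) b ≡ Bpmₛ s b - signedMoment s b
Bpmₛ-shift-expansion s b = begin
  Bpmₛ (suc s) b
    ≡⟨ alt-cong (λ k → trans (cong +_ (shiftedS-suc s b k))
                      (trans (ℤP.pos-+ (shiftedS s b k) _) (cong (_+_ (c k)) (ℤP.pos-* (suc k) _)))) b ⟩
  alt (λ k → c k + d (suc k)) b
    ≡⟨ alt-+ c (λ k → d (suc k)) b ⟩
  alt c b + alt (λ k → d (suc k)) b
    ≡⟨ cong (_+_ (alt c b)) (alt-shiftˡ d b) ⟩
  alt c b + (+ 0 * c 0 - alt d (suc b))
    ≡⟨ identity (alt c b) (c 0) (alt d (suc b)) ⟩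
  Bpmₛ s b - signedMoment s b ∎
  where
  open ≡-Reasoning
  c d : ℕ → ℤ
  c k = + shiftedS s b k
  d k = + k * c k
  identity : ∀ A x G → A + (+ 0 * x - G) ≡ A - G
  identity = ℤSolver.solve-∀

Bpmₛ-suc : ∀ s b → Bpmₛ s (suc b) ≡ + s * Bpmₛ s b - Bpmₛ (suc s) b
Bpmₛ-suc s b rewrite Bpmₛ-suc-expansion s b | Bpmₛ-shift-expansion s b = identity (+ s) (Bpmₛ s b) (signedMoment s b)
  where
  identity : ∀ s A G → - A + (s * A + G) ≡ s * A - (A - G)
  identity = ℤSolver.solve-∀

-- Powers of 2 and the weight of a function of s

2^_ : ℕ → ℤ
2^ e = + (2 ^ e)

2^-∣-mono : ∀ {e e′} → e ≤ e′ → 2^ e ∣ 2^ e′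
2^-∣-mono {e} {e′} e≤e′ = ∣ᵤ⇒∣ (subst (ℕD._∣_ (2 ^ e)) (cong (2 ^_) (ℕP.m∸n+n≡m e≤e′))
  (subst (ℕD._∣_ (2 ^ e)) (sym (ℕP.^-distribˡ-+-* 2 (e′ ℕ.∸ e) e)) (ℕD.n∣m*n (2 ^ (e′ ℕ.∸ e)))))

∣-2^-weaken : ∀ {e e′ z} → e ≤ e′ → 2^ e′ ∣ z → 2^ e ∣ z
∣-2^-weaken e≤e′ = ∣-trans (2^-∣-mono e≤e′)

∣-2^-double : ∀ {e z} → 2^ e ∣ z → 2^ suc e ∣ + 2 * z
∣-2^-double {e} d = subst (_∣ _) (sym (ℤP.pos-* 2 (2 ^ e))) (*-monoʳ-∣ (+ 2) d)

Δ : ℕ → (ℕ → ℤ) → ℕ → ℤ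
Δ N f a = f (N ℕ.+ a) - f a

Δ-cong : ∀ {u v} → (∀ a → u a ≡ v a) → ∀ N a → Δ N u a ≡ Δ N v a
Δ-cong u≡v N a = cong₂ _-_ (u≡v (N ℕ.+ a)) (u≡v a)

Δ₂^ : ℕ → (ℕ → ℤ) → ℕ → ℤ
Δ₂^ zero    f = f
Δ₂^ (suc k) f = Δ₂^ k (Δ 2 f)

Δ₂^-cong : ∀ {f g} → (∀ s → f s ≡ g s) → ∀ k s → Δ₂^ k f s ≡ Δ₂^ k g s
Δ₂^-cong f≡g zero    s = f≡g s
Δ₂^-cong f≡g (suc k) s = Δ₂^-cong (λ s → cong₂ _-_ (f≡g (2 ℕ.+ s)) (f≡g s)) k s

Δ₂^-+ : ∀ f g k s → Δ₂^ k (λ s → f s + g s) s ≡ Δ₂^ k f s + Δ₂^ k g s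
Δ₂^-+ f g zero    s = refl
Δ₂^-+ f g (suc k) s =
  trans (Δ₂^-cong (λ s → identity (f (2 ℕ.+ s)) (g (2 ℕ.+ s)) (f s) (g s)) k s) (Δ₂^-+ (Δ 2 f) (Δ 2 g) k s)
  where
  identity : ∀ a b c d → (a + b) - (c + d) ≡ (a - c) + (b - d)
  identity = ℤSolver.solve-∀

Δ₂^-* : ∀ c f k s → Δ₂^ k (λ s → c * f s) s ≡ c * Δ₂^ k f s
Δ₂^-* c f zero    s = refl
Δ₂^-* c f (suc k) s =
  trans (Δ₂^-cong (λ s → identity c (f (2 ℕ.+ s)) (f s)) k s) (Δ₂^-* c (Δ 2 f) k s)
  where
  identity : ∀ c a b → c * a - c * b ≡ c * (a - b)
  identity = ℤSolver.solve-∀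

Δ₂^-shift : ∀ f k s → Δ₂^ k (λ s → f (suc s)) s ≡ Δ₂^ k f (suc s)
Δ₂^-shift f zero    s = refl
Δ₂^-shift f (suc k) s = Δ₂^-shift (Δ 2 f) k s

Δ₂^-zero : ∀ k s → Δ₂^ k (λ _ → + 0) s ≡ + 0
Δ₂^-zero zero    s = refl
Δ₂^-zero (suc k) s = Δ₂^-zero k s

record Weight (n : ℕ) (f : ℕ → ℤ) : Set where
  constructor weight
  field Δ₂^-divisible : ∀ k s → 2^ ⌈ n ℕ.+ k /2⌉ ∣ Δ₂^ k f s
open Weight

weight-reindex : ∀ n k {z} → 2^ ⌈ suc n ℕ.+ k /2⌉ ∣ z → 2^ ⌈ n ℕ.+ suc k /2⌉ ∣ z
weight-reindex n k {z} = subst (λ e → 2^ ⌈ e /2⌉ ∣ z) (sym (ℕP.+-suc n k))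

weight-cong : ∀ {n f g} → (∀ s → f s ≡ g s) → Weight n f → Weight n g
weight-cong f≡g w = weight λ k s → subst (_ ∣_) (Δ₂^-cong f≡g k s) (Δ₂^-divisible w k s)

weight-+ : ∀ {n f g} → Weight n f → Weight n g → Weight n (λ s → f s + g s)
weight-+ {f = f} {g} wf wg = weight λ k s →
  subst (_ ∣_) (sym (Δ₂^-+ f g k s)) (∣m∣n⇒∣m+n (Δ₂^-divisible wf k s) (Δ₂^-divisible wg k s))

weight-* : ∀ {n f} c → Weight n f → Weight n (λ s → c * f s)
weight-* {f = f} c w = weight λ k s → subst (_ ∣_) (sym (Δ₂^-* c f k s)) (∣n⇒∣m*n c (Δ₂^-divisible w k s))

weight-- : ∀ {n f g} → Weight n f → Weight n g → Weight n (λ s → f s - g s)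
weight-- {g = g} wf wg = weight-+ wf (weight-cong (λ s → ℤP.-1*i≡-i (g s)) (weight-* (- + 1) wg))

weight-2* : ∀ {n f} → Weight n f → Weight (2 ℕ.+ n) (λ s → + 2 * f s)
weight-2* {n} {f} w = weight λ k s →
  subst (_ ∣_) (sym (Δ₂^-* (+ 2) f k s)) (∣-2^-double {⌈ n ℕ.+ k /2⌉} (Δ₂^-divisible w k s))

weight-mono : ∀ {m n f} → m ≤ n → Weight n f → Weight m f
weight-mono m≤n w = weight λ k s →
  ∣-2^-weaken (ℕP.⌈n/2⌉-mono (ℕP.+-monoˡ-≤ k m≤n)) (Δ₂^-divisible w k s)

weight-shift : ∀ {n f} → Weight n f → Weight n (λ s → f (suc s))
weight-shift {f = f} w = weight λ k s → subst (_ ∣_) (sym (Δ₂^-shift f k s)) (Δ₂^-divisible w k (suc s))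

weight-Δ : ∀ {n f} → Weight n f → Weight (suc n) (Δ 2 f)
weight-Δ {n} {f} w = weight λ k s →
  subst (λ e → 2^ ⌈ e /2⌉ ∣ Δ₂^ k (Δ 2 f) s) (ℕP.+-suc n k) (Δ₂^-divisible w (suc k) s)

weight-const : ∀ c → Weight 0 (λ _ → c)
weight-const c = weight λ where
  zero    s → divides c (sym (ℤP.*-identityʳ c))
  (suc k) s → subst (_ ∣_) (sym (trans (Δ₂^-cong (λ _ → ℤP.+-inverseʳ c) k s) (Δ₂^-zero k s)))
                    (divides (+ 0) refl)

Δ₂^-shift₂ : ∀ f k s → Δ₂^ k (λ s → f (2 ℕ.+ s)) s ≡ Δ₂^ k f (2 ℕ.+ s)
Δ₂^-shift₂ f k s = trans (Δ₂^-shift (λ s → f (suc s)) k s) (Δ₂^-shift f k (suc s))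

Δ₂^-suc-split : ∀ f g c h → (∀ s → Δ 2 f s ≡ g s + c * h s) →
  ∀ k s → Δ₂^ (suc k) f s ≡ Δ₂^ k g s + c * Δ₂^ k h s
Δ₂^-suc-split f g c h split k s =
  trans (Δ₂^-cong split k s) (trans (Δ₂^-+ g (λ s → c * h s) k s) (cong (_+_ (Δ₂^ k g s)) (Δ₂^-* c h k s)))

⌈1+n/2⌉≤1+⌈n/2⌉ : ∀ n → ⌈ suc n /2⌉ ≤ suc ⌈ n /2⌉
⌈1+n/2⌉≤1+⌈n/2⌉ n = s≤s (ℕP.⌊n/2⌋≤⌈n/2⌉ n)

-- The product rule's extra term 2 · f (2 + s) has lower weight, but its factor 2 pays for that.
weight-*s : ∀ {n f} → Weight n f → Weight n (λ s → + s * f s)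
weight-*s w = weight (divisible w)
  where
  Δ-*s : ∀ f s → Δ 2 (λ s → + s * f s) s ≡ + s * Δ 2 f s + + 2 * f (2 ℕ.+ s)
  Δ-*s f s = trans (cong (λ c → c * f (2 ℕ.+ s) - + s * f s) (ℤP.pos-+ 2 s)) (identity (+ s) (f (2 ℕ.+ s)) (f s))
    where
    identity : ∀ s a b → (+ 2 + s) * a - s * b ≡ s * (a - b) + + 2 * a
    identity = ℤSolver.solve-∀
  divisible : ∀ {n f} → Weight n f → ∀ k s → 2^ ⌈ n ℕ.+ k /2⌉ ∣ Δ₂^ k (λ s → + s * f s) s
  divisible w zero    s = ∣n⇒∣m*n (+ s) (Δ₂^-divisible w 0 s)
  divisible {n} {f} w (suc k) s = subst (_ ∣_) (sym split) (∣m∣n⇒∣m+n main-term error-term)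
    where
    split : Δ₂^ (suc k) (λ s → + s * f s) s ≡ Δ₂^ k (λ s → + s * Δ 2 f s) s + + 2 * Δ₂^ k f (2 ℕ.+ s)
    split = trans (Δ₂^-suc-split (λ s → + s * f s) (λ s → + s * Δ 2 f s) (+ 2) (λ s → f (2 ℕ.+ s))
                                 (Δ-*s f) k s)
                  (cong (λ z → Δ₂^ k (λ s → + s * Δ 2 f s) s + + 2 * z) (Δ₂^-shift₂ f k s))
    main-term : 2^ ⌈ n ℕ.+ suc k /2⌉ ∣ Δ₂^ k (λ s → + s * Δ 2 f s) s
    main-term = weight-reindex n k (divisible (weight-Δ w) k s)
    error-term : 2^ ⌈ n ℕ.+ suc k /2⌉ ∣ + 2 * Δ₂^ k f (2 ℕ.+ s)
    error-term = weight-reindex n k (∣-2^-weaken {e′ = suc ⌈ n ℕ.+ k /2⌉} (⌈1+n/2⌉≤1+⌈n/2⌉ (n ℕ.+ k))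
                   (∣-2^-double {⌈ n ℕ.+ k /2⌉} (Δ₂^-divisible w k (2 ℕ.+ s))))

2∣s[1+s] : ∀ s → + 2 ∣ + s * + suc s
2∣s[1+s] s = ∣ᵤ⇒∣ (subst (ℕD._∣_ 2) (sym (ℤP.abs-* (+ s) (+ suc s))) (even s))
  where
  even : ∀ s → 2 ℕD.∣ s ℕ.* suc s
  even zero    = ℕD.divides 0 refl
  even (suc s) = subst (2 ℕD.∣_) (identity s) (ℕD.∣m∣n⇒∣m+n (even s) (ℕD.n∣m*n (suc s)))
    where
    identity : ∀ s → s ℕ.* suc s ℕ.+ suc s ℕ.* 2 ≡ suc s ℕ.* suc (suc s)
    identity = ℕSolver.solve-∀

-- As for weight-*s; the evenness of s(s+1) gains one unit of weight.
weight-*s[1+s] : ∀ {n f} → Weight n f → Weight (suc n) (λ s → (+ s * + suc s) * f s)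
weight-*s[1+s] w = weight (divisible w)
  where
  error : (ℕ → ℤ) → ℕ → ℤ
  error f s = + 2 * (+ s * f (2 ℕ.+ s)) + + 3 * f (2 ℕ.+ s)
  weight-error : ∀ {n f} → Weight n f → Weight n (error f)
  weight-error w = weight-+ (weight-* (+ 2) (weight-*s (weight-shift (weight-shift w))))
                            (weight-* (+ 3) (weight-shift (weight-shift w)))
  Δ-*s[1+s] : ∀ f s → Δ 2 (λ s → (+ s * + suc s) * f s) s ≡ (+ s * + suc s) * Δ 2 f s + + 2 * error f s
  Δ-*s[1+s] f s = begin
    (+ (2 ℕ.+ s) * + (3 ℕ.+ s)) * f (2 ℕ.+ s) - (+ s * + (1 ℕ.+ s)) * f s
      ≡⟨ cong₂ (λ a b → (a * b) * f (2 ℕ.+ s) - (+ s * + suc s) * f s) (ℤP.pos-+ 2 s) (ℤP.pos-+ 3 s) ⟩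
    ((+ 2 + + s) * (+ 3 + + s)) * f (2 ℕ.+ s) - (+ s * + (1 ℕ.+ s)) * f s
      ≡⟨ cong (λ a → ((+ 2 + + s) * (+ 3 + + s)) * f (2 ℕ.+ s) - (+ s * a) * f s) (ℤP.pos-+ 1 s) ⟩
    ((+ 2 + + s) * (+ 3 + + s)) * f (2 ℕ.+ s) - (+ s * (+ 1 + + s)) * f s
      ≡⟨ identity (+ s) (f (2 ℕ.+ s)) (f s) ⟩
    (+ s * (+ 1 + + s)) * Δ 2 f s + + 2 * error f s
      ≡⟨ cong (λ a → (+ s * a) * Δ 2 f s + + 2 * error f s) (sym (ℤP.pos-+ 1 s)) ⟩
    (+ s * + suc s) * Δ 2 f s + + 2 * error f s ∎
    where
    open ≡-Reasoning
    identity : ∀ s a b → ((+ 2 + s) * (+ 3 + s)) * a - (s * (+ 1 + s)) * b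
                       ≡ (s * (+ 1 + s)) * (a - b) + + 2 * (+ 2 * (s * a) + + 3 * a)
    identity = ℤSolver.solve-∀
  divisible : ∀ {n f} → Weight n f →
              ∀ k s → 2^ ⌈ suc n ℕ.+ k /2⌉ ∣ Δ₂^ k (λ s → (+ s * + suc s) * f s) s
  divisible {n} {f} w zero s =
    ∣-2^-weaken {e′ = suc ⌈ n ℕ.+ 0 /2⌉} (⌈1+n/2⌉≤1+⌈n/2⌉ (n ℕ.+ 0))
      (∣-trans (∣-2^-double {⌈ n ℕ.+ 0 /2⌉} (Δ₂^-divisible w 0 s)) (*-monoˡ-∣ (f s) (2∣s[1+s] s)))
  divisible {n} {f} w (suc k) s = subst (_ ∣_) (sym split) (∣m∣n⇒∣m+n main-term error-term)
    where
    split : Δ₂^ (suc k) (λ s → (+ s * + suc s) * f s) s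
            ≡ Δ₂^ k (λ s → (+ s * + suc s) * Δ 2 f s) s + + 2 * Δ₂^ k (error f) s
    split = Δ₂^-suc-split (λ s → (+ s * + suc s) * f s) (λ s → (+ s * + suc s) * Δ 2 f s) (+ 2) (error f)
                          (Δ-*s[1+s] f) k s
    main-term : 2^ ⌈ suc n ℕ.+ suc k /2⌉ ∣ Δ₂^ k (λ s → (+ s * + suc s) * Δ 2 f s) s
    main-term = weight-reindex (suc n) k (divisible (weight-Δ w) k s)
    error-term : 2^ ⌈ suc n ℕ.+ suc k /2⌉ ∣ + 2 * Δ₂^ k (error f) s
    error-term = weight-reindex (suc n) k (∣-2^-double {⌈ n ℕ.+ k /2⌉} (Δ₂^-divisible (weight-error w) k s))

-- Weighted sequences and operators raising the weight

record Weighted (n : ℕ) (u : ℕ → ℤ) : Set where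
  field
    grid        : ℕ → ℕ → ℤ
    grid-row₀   : ∀ b → grid 0 b ≡ u b
    grid-suc    : ∀ s b → grid s (suc b) ≡ + s * grid s b - grid (suc s) b
    grid-weight : ∀ b → Weight n (λ s → grid s b)
open Weighted

weighted-divisible : ∀ {n u} → Weighted n u → ∀ b → 2^ ⌈ n /2⌉ ∣ u b
weighted-divisible {n} W b =
  subst₂ (λ e z → 2^ ⌈ e /2⌉ ∣ z) (ℕP.+-identityʳ n) (grid-row₀ W b) (Δ₂^-divisible (grid-weight W b) 0 0)

weighted-2^-divisible : ∀ {n u} e → e ℕ.+ e ≤ n → Weighted n u → ∀ b → 2^ e ∣ u b
weighted-2^-divisible e e+e≤n U b =
  ∣-2^-weaken (ℕP.≤-trans (ℕP.≤-reflexive (ℕP.n≡⌈n+n/2⌉ e)) (ℕP.⌈n/2⌉-mono e+e≤n))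
              (weighted-divisible U b)

weighted-cong : ∀ {n u v} → (∀ b → u b ≡ v b) → Weighted n u → Weighted n v
weighted-cong u≡v W = record
  { grid        = grid W
  ; grid-row₀   = λ b → trans (grid-row₀ W b) (u≡v b)
  ; grid-suc    = grid-suc W
  ; grid-weight = grid-weight W
  }

weighted-mono : ∀ {m n u} → m ≤ n → Weighted n u → Weighted m u
weighted-mono m≤n W = record
  { grid        = grid W
  ; grid-row₀   = grid-row₀ W
  ; grid-suc    = grid-suc W
  ; grid-weight = λ b → weight-mono m≤n (grid-weight W b)
  }

weighted-shift : ∀ {n u} → Weighted n u → Weighted n (λ b → u (suc b))
weighted-shift W = record
  { grid        = λ s b → grid W s (suc b)
  ; grid-row₀   = λ b → grid-row₀ W (suc b)
  ; grid-suc    = λ s b → grid-suc W s (suc b)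
  ; grid-weight = λ b → grid-weight W (suc b)
  }

weighted-+ : ∀ {n u v} → Weighted n u → Weighted n v → Weighted n (λ b → u b + v b)
weighted-+ U V = record
  { grid        = λ s b → grid U s b + grid V s b
  ; grid-row₀   = λ b → cong₂ _+_ (grid-row₀ U b) (grid-row₀ V b)
  ; grid-suc    = λ s b → trans (cong₂ _+_ (grid-suc U s b) (grid-suc V s b))
                                (identity (+ s) (grid U s b) (grid U (suc s) b) (grid V s b) (grid V (suc s) b))
  ; grid-weight = λ b → weight-+ (grid-weight U b) (grid-weight V b)
  }
  where
  identity : ∀ s a a′ c c′ → (s * a - a′) + (s * c - c′) ≡ s * (a + c) - (a′ + c′)
  identity = ℤSolver.solve-∀

weighted-* : ∀ {n u} c → Weighted n u → Weighted n (λ b → c * u b)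
weighted-* c U = record
  { grid        = λ s b → c * grid U s b
  ; grid-row₀   = λ b → cong (c *_) (grid-row₀ U b)
  ; grid-suc    = λ s b → trans (cong (c *_) (grid-suc U s b)) (identity c (+ s) (grid U s b) (grid U (suc s) b))
  ; grid-weight = λ b → weight-* c (grid-weight U b)
  }
  where
  identity : ∀ c s a a′ → c * (s * a - a′) ≡ s * (c * a) - c * a′
  identity = ℤSolver.solve-∀

weighted-- : ∀ {n u v} → Weighted n u → Weighted n v → Weighted n (λ b → u b - v b)
weighted-- {v = v} U V = weighted-+ U (weighted-cong (λ b → ℤP.-1*i≡-i (v b)) (weighted-* (- + 1) V))

weighted-2* : ∀ {n u} → Weighted n u → Weighted (2 ℕ.+ n) (λ b → + 2 * u b)
weighted-2* U = record
  { grid        = grid 2U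
  ; grid-row₀   = grid-row₀ 2U
  ; grid-suc    = grid-suc 2U
  ; grid-weight = λ b → weight-2* (grid-weight U b)
  }
  where
  2U = weighted-* (+ 2) U

grid-step : ∀ {n u} (W : Weighted n u) s b → grid W (suc s) b ≡ + s * grid W s b - grid W s (suc b)
grid-step W s b = solve-for {a = + s * grid W s b} (grid-suc W s b)
  where
  solve-for : ∀ {x a y} → x ≡ a - y → y ≡ a - x
  solve-for {x} {a} {y} refl = identity a y
    where
    identity : ∀ a y → y ≡ a - (a - y)
    identity = ℤSolver.solve-∀

fibΔ : (ℕ → ℤ) → ℕ → ℤ
fibΔ u b = u (2 ℕ.+ b) - u (1 ℕ.+ b) - u b

fibΔ-grid-suc : ∀ {n u} (W : Weighted n u) s b →
  fibΔ (grid W s) (suc b) ≡ + s * fibΔ (grid W s) b - fibΔ (grid W (suc s)) b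
fibΔ-grid-suc W s b =
  trans (cong₂ _-_ (cong₂ _-_ (grid-suc W s (2 ℕ.+ b)) (grid-suc W s (1 ℕ.+ b))) (grid-suc W s b))
        (identity (+ s) (Y s b) (Y s (1 ℕ.+ b)) (Y s (2 ℕ.+ b))
                        (Y (suc s) b) (Y (suc s) (1 ℕ.+ b)) (Y (suc s) (2 ℕ.+ b)))
  where
  Y = grid W
  identity : ∀ s a₀ a₁ a₂ c₀ c₁ c₂ →
    (s * a₂ - c₂) - (s * a₁ - c₁) - (s * a₀ - c₀) ≡ s * (a₂ - a₁ - a₀) - (c₂ - c₁ - c₀)
  identity = ℤSolver.solve-∀

-- Each of the three terms on the left has weight n + 1: this is where fibΔ gains.
fibΔ-grid-expansion : ∀ {n u} (W : Weighted n u) b s →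
  Δ 2 (λ s → grid W s b) s + + 2 * (+ s * grid W s (suc b)) - (+ s * + suc s) * grid W s b ≡ fibΔ (grid W s) b
fibΔ-grid-expansion W b s = begin
  Y (2 ℕ.+ s) b - Y s b + + 2 * (+ s * Y s (suc b)) - (+ s * + suc s) * Y s b
    ≡⟨ cong (λ z → z - Y s b + + 2 * (+ s * Y s (suc b)) - (+ s * + suc s) * Y s b) Y[2+s] ⟩
  (+ suc s * (+ s * Y s b - Y s (1 ℕ.+ b)) - (+ s * Y s (1 ℕ.+ b) - Y s (2 ℕ.+ b))) - Y s b
    + + 2 * (+ s * Y s (suc b)) - (+ s * + suc s) * Y s b
    ≡⟨ cong (λ t → (t * (+ s * Y s b - Y s (1 ℕ.+ b)) - (+ s * Y s (1 ℕ.+ b) - Y s (2 ℕ.+ b))) - Y s b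
                     + + 2 * (+ s * Y s (suc b)) - (+ s * t) * Y s b) (ℤP.pos-+ 1 s) ⟩
  (((+ 1 + + s) * (+ s * Y s b - Y s (1 ℕ.+ b)) - (+ s * Y s (1 ℕ.+ b) - Y s (2 ℕ.+ b))) - Y s b
    + + 2 * (+ s * Y s (suc b)) - (+ s * (+ 1 + + s)) * Y s b)
    ≡⟨ identity (+ s) (Y s b) (Y s (1 ℕ.+ b)) (Y s (2 ℕ.+ b)) ⟩
  fibΔ (Y s) b ∎
  where
  open ≡-Reasoning
  Y = grid W
  Y[2+s] : Y (2 ℕ.+ s) b ≡ + suc s * (+ s * Y s b - Y s (1 ℕ.+ b)) - (+ s * Y s (1 ℕ.+ b) - Y s (2 ℕ.+ b))
  Y[2+s] = trans (grid-step W (suc s) b) (cong₂ (λ x y → + suc s * x - y) (grid-step W s b) (grid-step W s (suc b)))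
  identity : ∀ s a₀ a₁ a₂ →
    ((+ 1 + s) * (s * a₀ - a₁) - (s * a₁ - a₂) - a₀) + + 2 * (s * a₁) - (s * (+ 1 + s)) * a₀
    ≡ a₂ - a₁ - a₀
  identity = ℤSolver.solve-∀

weighted-fibΔ : ∀ {n u} → Weighted n u → Weighted (suc n) (fibΔ u)
weighted-fibΔ {n} W = record
  { grid        = λ s → fibΔ (grid W s)
  ; grid-row₀   = λ b → cong₂ _-_ (cong₂ _-_ (grid-row₀ W (2 ℕ.+ b)) (grid-row₀ W (1 ℕ.+ b))) (grid-row₀ W b)
  ; grid-suc    = fibΔ-grid-suc W
  ; grid-weight = λ b → weight-cong (fibΔ-grid-expansion W b)
      (weight-- (weight-+ (weight-Δ (grid-weight W b))
                          (weight-mono (ℕP.n≤1+n (suc n)) (weight-2* (weight-*s (grid-weight W (suc b))))))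
                (weight-*s[1+s] (grid-weight W b)))
  }

weight-Bpmₛ : ∀ b → Weight 0 (λ s → Bpmₛ s b)
weight-Bpmₛ zero    = weight-const (+ 1)
weight-Bpmₛ (suc b) =
  weight-cong (λ s → sym (Bpmₛ-suc s b)) (weight-- (weight-*s (weight-Bpmₛ b)) (weight-shift (weight-Bpmₛ b)))

weighted-Bpm : Weighted 0 Bpm
weighted-Bpm = record
  { grid = Bpmₛ ; grid-row₀ = Bpmₛ-zero ; grid-suc = Bpmₛ-suc ; grid-weight = weight-Bpmₛ }

Gains : ℕ → ℕ → Set
Gains N w = ∀ {n u} → Weighted n u → Weighted (n ℕ.+ w) (Δ N u)

gains-cong : ∀ {N N′ w w′} → N ≡ N′ → w ≡ w′ → Gains N w → Gains N′ w′
gains-cong refl refl g = g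

gains-3 : Gains 3 1
gains-3 {n} {u} U = subst (λ m → Weighted m (Δ 3 u)) (ℕP.+-comm 1 n) (weighted-cong Δ₃-via-fibΔ
  (weighted-+ (weighted-- (weighted-shift (weighted-fibΔ U)) (weighted-fibΔ U))
              (weighted-mono (ℕP.n≤1+n (suc n)) (weighted-2* (weighted-- (weighted-shift (weighted-shift U)) U)))))
  where
  Δ₃-via-fibΔ : ∀ b → (fibΔ u (suc b) - fibΔ u b) + + 2 * (u (2 ℕ.+ b) - u b) ≡ Δ 3 u b
  Δ₃-via-fibΔ b = identity (u b) (u (1 ℕ.+ b)) (u (2 ℕ.+ b)) (u (3 ℕ.+ b))
    where
    identity : ∀ a₀ a₁ a₂ a₃ → ((a₃ - a₂ - a₁) - (a₂ - a₁ - a₀)) + + 2 * (a₂ - a₀) ≡ a₃ - a₀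
    identity = ℤSolver.solve-∀

Δ-double : ∀ N u a → Δ (N ℕ.+ N) u a ≡ Δ N (Δ N u) a + + 2 * Δ N u a
Δ-double N u a =
  trans (cong (λ i → u i - u a) (ℕP.+-assoc N N a)) (identity (u a) (u (N ℕ.+ a)) (u (N ℕ.+ (N ℕ.+ a))))
  where
  identity : ∀ a₀ a₁ a₂ → a₂ - a₀ ≡ ((a₂ - a₁) - (a₁ - a₀)) + + 2 * (a₁ - a₀)
  identity = ℤSolver.solve-∀

gains-double : ∀ {N w v} → v ≤ w ℕ.+ w → v ≤ 2 ℕ.+ w → Gains N w → Gains (N ℕ.+ N) v
gains-double {N} {w} v≤w+w v≤2+w gains {n} {u} U = weighted-cong (λ a → sym (Δ-double N u a))
  (weighted-+ (weighted-mono (ℕP.≤-trans (ℕP.+-monoʳ-≤ n v≤w+w) (ℕP.≤-reflexive (sym (ℕP.+-assoc n w w))))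
                             (gains (gains U)))
              (weighted-mono (ℕP.≤-trans (ℕP.+-monoʳ-≤ n v≤2+w)
                                         (ℕP.≤-reflexive (trans (ℕP.+-suc n (suc w)) (cong suc (ℕP.+-suc n w)))))
                             (weighted-2* (gains U))))

gains-6·2^ : ∀ K → Gains (6 ℕ.* 2 ^ K) (2 ℕ.* suc K)
gains-6·2^ zero    = gains-double ℕP.≤-refl (ℕP.n≤1+n 2) gains-3
gains-6·2^ (suc K) = gains-cong (doubled-step (2 ^ K)) refl
  (gains-double (ℕP.≤-trans (ℕP.m≤m+n _ (2 ℕ.* K)) (ℕP.≤-reflexive (doubled-weight K)))
                (ℕP.≤-reflexive (weight+2 K))
                (gains-6·2^ K))
  where
  doubled-step : ∀ P → 6 ℕ.* P ℕ.+ 6 ℕ.* P ≡ 6 ℕ.* (2 ℕ.* P)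
  doubled-step = ℕSolver.solve-∀
  doubled-weight : ∀ K → 2 ℕ.* suc (suc K) ℕ.+ 2 ℕ.* K ≡ 2 ℕ.* suc K ℕ.+ 2 ℕ.* suc K
  doubled-weight = ℕSolver.solve-∀
  weight+2 : ∀ K → 2 ℕ.* suc (suc K) ≡ 2 ℕ.+ 2 ℕ.* suc K
  weight+2 = ℕSolver.solve-∀

gains-24·2^ : ∀ m → Gains (24 ℕ.* 2 ^ m) (6 ℕ.+ 2 ℕ.* m)
gains-24·2^ m = gains-cong (index (2 ^ m)) (exponent m) (gains-6·2^ (2 ℕ.+ m))
  where
  index : ∀ P → 6 ℕ.* (2 ℕ.* (2 ℕ.* P)) ≡ 24 ℕ.* P
  index = ℕSolver.solve-∀
  exponent : ∀ m → 2 ℕ.* suc (2 ℕ.+ m) ≡ 6 ℕ.+ 2 ℕ.* m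
  exponent = ℕSolver.solve-∀

-- Congruences modulo powers of 2

infix 4 _≡_[mod_]
record _≡_[mod_] (a b d : ℤ) : Set where
  constructor congruent
  field divides-difference : d ∣ a - b
open _≡_[mod_]

≡mod-+ : ∀ {a b c e d} → a ≡ b [mod d ] → c ≡ e [mod d ] → a + c ≡ b + e [mod d ]
≡mod-+ {a} {b} {c} {e} (congruent p) (congruent q) = congruent (subst (_ ∣_) (identity a b c e) (∣m∣n⇒∣m+n p q))
  where
  identity : ∀ a b c e → (a - b) + (c - e) ≡ (a + c) - (b + e)
  identity = ℤSolver.solve-∀

≡mod-trans : ∀ {a b c d} → a ≡ b [mod d ] → b ≡ c [mod d ] → a ≡ c [mod d ]
≡mod-trans {a} {b} {c} (congruent p) (congruent q) = congruent (subst (_ ∣_) (identity a b c) (∣m∣n⇒∣m+n p q))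
  where
  identity : ∀ a b c → (a - b) + (b - c) ≡ a - c
  identity = ℤSolver.solve-∀

≡mod-2* : ∀ {a b e} → a ≡ b [mod 2^ e ] → + 2 * a ≡ + 2 * b [mod 2^ suc e ]
≡mod-2* {a} {b} {e} (congruent p) = congruent (subst (_ ∣_) (identity a b) (∣-2^-double {e} p))
  where
  identity : ∀ a b → + 2 * (a - b) ≡ + 2 * a - + 2 * b
  identity = ℤSolver.solve-∀

∣⇒≡mod0 : ∀ {a d} → d ∣ a → a ≡ + 0 [mod d ]
∣⇒≡mod0 {a} p = congruent (subst (_ ∣_) (sym (ℤP.+-identityʳ a)) p)

telescope : ∀ {M b c d} u → (∀ n → Δ M u (M ℕ.* n ℕ.+ b) ≡ + c [mod d ]) →
            ∀ n → u (M ℕ.* n ℕ.+ b) ≡ u b + + (c ℕ.* n) [mod d ]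
telescope {M} {b} {c} {d} u step zero
  rewrite ℕP.*-zeroʳ M | ℕP.*-zeroʳ c = congruent (subst (d ∣_) (sym (identity (u b))) (divides (+ 0) refl))
  where
  identity : ∀ x → x - (x + + 0) ≡ + 0
  identity = ℤSolver.solve-∀
telescope {M} {b} {c} {d} u step (suc n) = subst₂ (λ x y → x ≡ y [mod d ])
  (trans (identity₁ (u (M ℕ.+ (M ℕ.* n ℕ.+ b))) (u (M ℕ.* n ℕ.+ b))) (cong u index))
  (trans (identity₂ (+ c) (u b) (+ (c ℕ.* n)))
         (cong (_+_ (u b)) (trans (sym (ℤP.pos-+ c (c ℕ.* n))) (cong +_ (sym (ℕP.*-suc c n))))))
  (≡mod-+ (step n) (telescope {M} u step n))
  where
  index : M ℕ.+ (M ℕ.* n ℕ.+ b) ≡ M ℕ.* suc n ℕ.+ b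
  index = trans (sym (ℕP.+-assoc M (M ℕ.* n) b)) (cong (ℕ._+ b) (sym (ℕP.*-suc M n)))
  identity₁ : ∀ y x → (y - x) + x ≡ y
  identity₁ = ℤSolver.solve-∀
  identity₂ : ∀ c x y → c + (x + y) ≡ x + (c + y)
  identity₂ = ℤSolver.solve-∀

≡mod-Δ-double : ∀ {M u a e} → Δ M u a ≡ 2^ e [mod 2^ suc e ] → Δ M (Δ M u) a ≡ + 0 [mod 2^ (2 ℕ.+ e) ] →
                Δ (M ℕ.+ M) u a ≡ 2^ suc e [mod 2^ (2 ℕ.+ e) ]
≡mod-Δ-double {M} {u} {a} {e} Δ≡2^e Δ²≡0 = subst₂ (λ x y → x ≡ y [mod 2^ (2 ℕ.+ e) ])
  (sym (Δ-double M u a)) (trans (ℤP.+-identityˡ (+ 2 * 2^ e)) (sym (ℤP.pos-* 2 (2 ^ e))))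
  (≡mod-+ Δ²≡0 (≡mod-2* {e = suc e} Δ≡2^e))

periodic : ∀ {P a d} f → (∀ b → d ∣ Δ P f b) → ∀ j → f (P ℕ.* j ℕ.+ a) ≡ f a [mod d ]
periodic {P} {a} {d} f d∣Δf j = subst (λ z → f (P ℕ.* j ℕ.+ a) ≡ z [mod d ]) (ℤP.+-identityʳ (f a))
  (telescope {P} {c = 0} f (λ n → ∣⇒≡mod0 (d∣Δf (P ℕ.* n ℕ.+ a))) j)

module _ {u : ℕ → ℤ} (U : Weighted 0 u) {a : ℕ}
         (Δ24≡32 : Δ 24 u a ≡ 2^ 5 [mod 2^ 6 ])
         (Δ24²≡0 : Δ 24 (Δ 24 u) a ≡ + 0 [mod 2^ 7 ]) where

  Δ24-congruence : ∀ j → Δ 24 u (24 ℕ.* j ℕ.+ a) ≡ 2^ 5 [mod 2^ 6 ]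
  Δ24-congruence j = ≡mod-trans
    (periodic (Δ 24 u) (weighted-2^-divisible 6 ℕP.≤-refl (gains-24·2^ 0 (gains-24·2^ 0 U))) j) Δ24≡32

  Δ24²-congruence : ∀ j → Δ 24 (Δ 24 u) (24 ℕ.* j ℕ.+ a) ≡ + 0 [mod 2^ 7 ]
  Δ24²-congruence j = ≡mod-trans
    (periodic (Δ 24 (Δ 24 u))
              (weighted-2^-divisible 7 (ℕP.m≤m+n 14 4) (gains-24·2^ 0 (gains-24·2^ 0 (gains-24·2^ 0 U)))) j)
    Δ24²≡0

  Δ-24·2^-square-congruence : ∀ m j →
    Δ (24 ℕ.* 2 ^ m) (Δ (24 ℕ.* 2 ^ m) u) (24 ℕ.* j ℕ.+ a) ≡ + 0 [mod 2^ (7 ℕ.+ m) ]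
  Δ-24·2^-square-congruence zero    j = Δ24²-congruence j
  Δ-24·2^-square-congruence (suc m) j =
    ∣⇒≡mod0 (weighted-2^-divisible (8 ℕ.+ m) (bound m) (gains-24·2^ (suc m) (gains-24·2^ (suc m) U)) _)
    where
    bound : ∀ m → (8 ℕ.+ m) ℕ.+ (8 ℕ.+ m) ≤ (6 ℕ.+ 2 ℕ.* suc m) ℕ.+ (6 ℕ.+ 2 ℕ.* suc m)
    bound m = ℕP.≤-trans (ℕP.m≤m+n _ (2 ℕ.* m)) (ℕP.≤-reflexive (identity m))
      where
      identity : ∀ m → (8 ℕ.+ m) ℕ.+ (8 ℕ.+ m) ℕ.+ 2 ℕ.* m
                       ≡ (6 ℕ.+ 2 ℕ.* suc m) ℕ.+ (6 ℕ.+ 2 ℕ.* suc m)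
      identity = ℕSolver.solve-∀

  Δ-24·2^-congruence : ∀ m j → Δ (24 ℕ.* 2 ^ m) u (24 ℕ.* j ℕ.+ a) ≡ 2^ (5 ℕ.+ m) [mod 2^ (6 ℕ.+ m) ]
  Δ-24·2^-congruence zero    j = Δ24-congruence j
  Δ-24·2^-congruence (suc m) j =
    subst (λ N → Δ N u (24 ℕ.* j ℕ.+ a) ≡ 2^ (6 ℕ.+ m) [mod 2^ (7 ℕ.+ m) ]) (index (2 ^ m))
      (≡mod-Δ-double {24 ℕ.* 2 ^ m} {u} {24 ℕ.* j ℕ.+ a} {5 ℕ.+ m}
                     (Δ-24·2^-congruence m j) (Δ-24·2^-square-congruence m j))
    where
    index : ∀ P → 24 ℕ.* P ℕ.+ 24 ℕ.* P ≡ 24 ℕ.* (2 ℕ.* P)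
    index = ℕSolver.solve-∀

  shift-congruence : ∀ m j n → u (24 ℕ.* 2 ^ m ℕ.* n ℕ.+ (24 ℕ.* j ℕ.+ a))
                         ≡ u (24 ℕ.* j ℕ.+ a) + + (2 ^ (5 ℕ.+ m) ℕ.* n) [mod 2^ (6 ℕ.+ m) ]
  shift-congruence m j = telescope {24 ℕ.* 2 ^ m} u λ n →
    subst (λ b → Δ (24 ℕ.* 2 ^ m) u b ≡ 2^ (5 ℕ.+ m) [mod 2^ (6 ℕ.+ m) ]) (index (2 ^ m) n j)
      (Δ-24·2^-congruence m (2 ^ m ℕ.* n ℕ.+ j))
    where
    index : ∀ P n j → 24 ℕ.* (P ℕ.* n ℕ.+ j) ℕ.+ a ≡ 24 ℕ.* P ℕ.* n ℕ.+ (24 ℕ.* j ℕ.+ a)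
    index P n j = trans (cong (ℕ._+ a) (identity P n j)) (ℕP.+-assoc (24 ℕ.* P ℕ.* n) (24 ℕ.* j) a)
      where
      identity : ∀ P n j → 24 ℕ.* (P ℕ.* n ℕ.+ j) ≡ 24 ℕ.* P ℕ.* n ℕ.+ 24 ℕ.* j
      identity = ℕSolver.solve-∀

-- Evaluating B^± at small arguments

entry : List ℕ → ℕ → ℕ
entry []       k       = 0
entry (x ∷ xs) zero    = x
entry (x ∷ xs) (suc k) = entry xs k

-- nextRow k [S n (k-1), S n k, …] = [S (n+1) k, …]: one sweep of the Stirling recurrence.
nextRow : ℕ → List ℕ → List ℕ
nextRow k []       = []
nextRow k (x ∷ xs) = k ℕ.* entry xs 0 ℕ.+ x ∷ nextRow (suc k) xs

-- Evaluating S n k directly takes time exponential in n; rows of the triangle are built in quadratic time.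
stirlingRow : ℕ → List ℕ
stirlingRow zero    = 1 ∷ []
stirlingRow (suc n) = 0 ∷ nextRow 1 (stirlingRow n)

entry-nextRow : ∀ k xs j → entry (nextRow k xs) j ≡ (k ℕ.+ j) ℕ.* entry xs (suc j) ℕ.+ entry xs j
entry-nextRow k []       j       = sym (trans (ℕP.+-identityʳ _) (ℕP.*-zeroʳ (k ℕ.+ j)))
entry-nextRow k (x ∷ xs) zero    = cong (λ i → i ℕ.* entry xs 0 ℕ.+ x) (sym (ℕP.+-identityʳ k))
entry-nextRow k (x ∷ xs) (suc j) =
  trans (entry-nextRow (suc k) xs j) (cong (λ i → i ℕ.* entry xs (suc j) ℕ.+ entry xs j) (sym (ℕP.+-suc k j)))

entry-stirlingRow : ∀ n k → entry (stirlingRow n) k ≡ S n k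
entry-stirlingRow zero    zero    = refl
entry-stirlingRow zero    (suc k) = refl
entry-stirlingRow (suc n) zero    = refl
entry-stirlingRow (suc n) (suc k) = trans (entry-nextRow 1 (stirlingRow n) k)
  (cong₂ (λ x y → suc k ℕ.* x ℕ.+ y) (entry-stirlingRow n (suc k)) (entry-stirlingRow n k))

fastBpm : ℕ → ℤ
fastBpm n = alt (λ k → + entry (stirlingRow n) k) n

Bpm≡fastBpm : ∀ n → Bpm n ≡ fastBpm n
Bpm≡fastBpm n = trans (partial≡alt n n) (alt-cong (λ k → cong +_ (sym (entry-stirlingRow n k))) n)

-- The implicit arguments of Δ-cong are given: inferring them would make Agda unfold Bpm 38 by the slow recursion.
Δ24-Bpm-14 : Δ 24 Bpm 14 ≡ 2^ 5 [mod 2^ 6 ]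
Δ24-Bpm-14 = subst (λ z → z ≡ 2^ 5 [mod 2^ 6 ]) (sym (Δ-cong {Bpm} {fastBpm} Bpm≡fastBpm 24 14))
  (congruent (toWitness {a? = 2^ 6 ∣? Δ 24 fastBpm 14 - 2^ 5} _))

Δ24²-Bpm-14 : Δ 24 (Δ 24 Bpm) 14 ≡ + 0 [mod 2^ 7 ]
Δ24²-Bpm-14 = subst (λ z → z ≡ + 0 [mod 2^ 7 ])
  (sym (Δ-cong {Δ 24 Bpm} {Δ 24 fastBpm} (Δ-cong {Bpm} {fastBpm} Bpm≡fastBpm 24) 24 14))
  (congruent (toWitness {a? = 2^ 7 ∣? Δ 24 (Δ 24 fastBpm) 14 - + 0} _))

lemma7p3 : (m n : ℕ) →
    (+ (2 ^ (m ℕ.+ 6))) Unsigned.∣ (Bpm (24 ℕ.* 2 ^ m ℕ.* n ℕ.+ x m) ℤ.- (Bpm (x m) ℤ.+ + (2 ^ (m ℕ.+ 5) ℕ.* n)))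
lemma7p3 m n =
  subst₂ (λ e₅ e₆ → + (2 ^ e₆) Unsigned.∣ Bpm (24 ℕ.* 2 ^ m ℕ.* n ℕ.+ x m) - (Bpm (x m) + + (2 ^ e₅ ℕ.* n)))
         (ℕP.+-comm 5 m) (ℕP.+-comm 6 m)
         (∣⇒∣ᵤ (divides-difference (shift-congruence weighted-Bpm {a = 14} Δ24-Bpm-14 Δ24²-Bpm-14 m (y m) n)))
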